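{- Let $n, d$ be positive integers with $d \ge n$, and let $k \in \mathbb{N}$ with $k \le n$. Let $\mathcal{Q}_{n,d,k} \subset \mathbb{R}^n$ be the polytope defined by $x_i \ge 0$ for $1 \le i \le n$, $x_i \le 1$ for $1 \le i \le k$, and $x_1 + \cdots + x_n \le d$. Then the Ehrhart polynomial of $\mathcal{Q}_{n,d,k}$ is magic positive; more precisely, $$ n!\,\mathrm{Ehr}(\mathcal{Q}_{n,d,k},t) = \sum_{i=0}^n c_i t^i (1+t)^{n-i}, $$ where $$ \sum_{i=0}^n c_i t^i = \sum_{w \in \mathcal{W}_{n,d,k}} t^{\mathrm{unlucky}(w)} $$ and $\mathcal{W}_{n,d,k}$ is the set of words $w \in [d]^n$ in which each of $1,2,\dots,k$ appears at least once.
   Context: For a lattice polytope $\mathcal{Q} \subset \mathbb{R}_{\ge 0}^n$, $\mathrm{Ehr}(\mathcal{Q},t)$ is the unique polynomial with $\mathrm{Ehr}(\mathcal{Q},m) = \#(m\mathcal{Q} \cap \mathbb{N}^n)$ for all $m \in \mathbb{N}$; it is called magic positive if $n!\,\mathrm{Ehr}(\mathcal{Q},t) = \sum_{i=0}^n c_i t^i(1+t)^{n-i}$ with all $c_i \ge 0$. Parking protocol: $n$ cars $C_1,\dots,C_n$ park on a street with spaces $1,\dots,n$; a word $w=(w_1,\dots,w_n) \in [d]^n$ gives the preferred space $w_i$ of car $C_i$. Cars park in order $C_1,\dots,C_n$: car $C_i$ parks in space $w_i$ if $w_i \le n$ and that space is free; otherwise (including whenever $w_i > n$, such a preference being considered unavailable)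 it parks in the largest-numbered free space. A car is lucky if it parks in its preferred space; $\mathrm{unlucky}(w)$ is the number of cars that are not lucky. -}

module Defs where

open import Data.Bool using (Bool; true; false; if_then_else_; _∧_; not)
open import Data.Nat using (ℕ; zero; suc; _+_; _*_; _∸_; _^_; _≤ᵇ_; _≡ᵇ_; _!)
open import Data.List using (List; []; _∷_; map; concatMap; filterᵇ; length; upTo)
open import Data.Bool.ListAction using (and)
open import Data.Nat.ListAction using (sum)

allLists : ℕ → List ℕ → List (List ℕ)
allLists zero    xs = [] ∷ []
allLists (suc n) xs = concatMap (λ x → map (x ∷_) (allLists n xs)) xs

range0 : ℕ → List ℕ
range0 b = upTo (suc b)

range1 : ℕ → List ℕ
range1 b = map suc (upTo b)

elem : ℕ → List ℕ → Bool
elem p []       = false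
elem p (q ∷ qs) = if p ≡ᵇ q then true else elem p qs

-- The polytope Q_{n,d,k}: x_i ≥ 0 (all i), x_i ≤ 1 (i ≤ k), Σ x_i ≤ d.
-- A point x ∈ ℕ^n (as a list of length n) lies in m·Q_{n,d,k} iff
-- x_i ≤ m for the first k coordinates and Σ x_i ≤ m·d.

firstBounded : ℕ → ℕ → List ℕ → Bool
firstBounded zero    m xs       = true
firstBounded (suc k) m []       = true
firstBounded (suc k) m (x ∷ xs) = (x ≤ᵇ m) ∧ firstBounded k m xs

inDilate : ℕ → ℕ → ℕ → List ℕ → Bool
inDilate d k m x = firstBounded k m x ∧ (sum x ≤ᵇ m * d)

-- #(m·Q_{n,d,k} ∩ ℕ^n).  Every lattice point of m·Q has all coordinates
-- ≤ Σ x_i ≤ m·d, so enumerating {0,…,m·d}^n loses no points.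
latticeCount : ℕ → ℕ → ℕ → ℕ → ℕ
latticeCount n d k m = length (filterᵇ (inDilate d k m) (allLists n (range0 (m * d))))

-- largest-numbered free space among 1..s (0 if none; never happens in use)
largestFree : ℕ → List ℕ → ℕ
largestFree zero    occ = zero
largestFree (suc s) occ = if elem (suc s) occ then largestFree s occ else suc s

parkUnlucky : ℕ → List ℕ → List ℕ → ℕ
parkUnlucky n occ []       = zero
parkUnlucky n occ (p ∷ ps) =
  if (1 ≤ᵇ p) ∧ (p ≤ᵇ n) ∧ not (elem p occ)
  then parkUnlucky n (p ∷ occ) ps
  else suc (parkUnlucky n (largestFree n occ ∷ occ) ps)

unlucky : ℕ → List ℕ → ℕ
unlucky n w = parkUnlucky n [] w

W : ℕ → ℕ → ℕ → List (List ℕ)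
W n d k = filterᵇ (λ w → and (map (λ j → elem j w) (range1 k))) (allLists n (range1 d))

coeff : ℕ → ℕ → ℕ → ℕ → ℕ
coeff n d k i = length (filterᵇ (λ w → unlucky n w ≡ᵇ i) (W n d k))

magicRHS : ℕ → ℕ → ℕ → ℕ → ℕ
magicRHS n d k m = sum (map (λ i → coeff n d k i * (m ^ i * (1 + m) ^ (n ∸ i))) (range0 n))

module Submission where

-- Evaluated at t = m, both sides equal E(n, k) (ehr n k below), where E(0, 0) = 1, E(0, j + 1) = 0 and
--   E(r + 1, j) = (m + 1)·j·E(r, j − 1) + ((m + 1)(r + 1 − j) + m(d − r − 1))·E(r, j).
-- Lattice side: E(r, j) = r!·#{x ∈ ℕ^r : x₁, …, x_j ≤ m, Σ x ≤ m·d}. The recurrence comes from an identity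
-- for these counts proved by induction on j: for a sum bound b ≤ m a new bound x_{j+1} ≤ m is vacuous, and
-- for b = c + m + 1 the points violating it are a translate of the points with sum bound c.
-- Parking side: Σ c_i m^i (1 + m)^(n − i) = Σ_{w ∈ W} m^unlucky(w) (1 + m)^lucky(w). Condition on the
-- preference p of the first car: a vacant p contributes 1 + m, anything else contributes m and the car takes
-- the largest vacant space. Throughout, the values among 1, …, k still missing form an initial segment of
-- the vacant spaces, so the weighted count depends only on the number r of vacancies and the number j of
-- missing values. When a car is sent to the largest vacancy although it is still missing, every vacancy
-- is missing, so more values are missing than cars remain: the count is 0, matching E(r, j) = 0 for j > r.

open import Defs
open import Data.Bool using (Bool; true; false; if_then_else_; _∧_; not)
open import Data.Bool.Properties using (T-≡; ¬-not; ∧-assoc; ∧-zeroʳ; ∧-identityʳ; ∧-conicalˡ; ∧-conicalʳ; not-injective)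
open import Data.Bool.ListAction using (and)
open import Data.Nat using (ℕ; zero; suc; _+_; _*_; _∸_; _^_; _!; _≤_; _<_; _≤ᵇ_; _<ᵇ_; _≡ᵇ_; z≤n; s≤s; pred)
open import Data.Nat.Properties
open import Data.Nat.ListAction using (sum)
open import Data.Nat.ListAction.Properties using (sum-++)
open import Data.Nat.Tactic.RingSolver using (solve-∀)
open import Data.List using (List; []; _∷_; map; concatMap; filterᵇ; length; upTo; applyUpTo; _++_)
open import Data.List.Properties using (map-++; map-cong; map-cong-local; filter-++; map-upTo)
open import Data.List.Relation.Unary.All as All using (All; []; _∷_)
open import Data.List.Relation.Unary.All.Properties using (concat⁺; map⁺; filter⁺)
open import Data.Product using (_×_; _,_; proj₁; proj₂; ∃)
open import Function using (_∘_; id; Equivalence)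
open import Relation.Nullary using (yes; no; contradiction)
open import Relation.Nullary.Decidable using (T?)
open import Relation.Binary.PropositionalEquality

open Equivalence using (to; from)

≤ᵇ-true : ∀ {a b} → a ≤ b → (a ≤ᵇ b) ≡ true
≤ᵇ-true = to T-≡ ∘ ≤⇒≤ᵇ

≤ᵇ-false : ∀ {a b} → b < a → (a ≤ᵇ b) ≡ false
≤ᵇ-false b<a = ¬-not (λ a≤ᵇb → <⇒≱ b<a (≤ᵇ⇒≤ _ _ (from T-≡ a≤ᵇb)))

≤ᵇ-sound : ∀ a b → (a ≤ᵇ b) ≡ true → a ≤ b
≤ᵇ-sound a b = ≤ᵇ⇒≤ a b ∘ from T-≡

≡ᵇ-sound : ∀ a b → (a ≡ᵇ b) ≡ true → a ≡ b
≡ᵇ-sound a b = ≡ᵇ⇒≡ a b ∘ from T-≡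

≡ᵇ-refl : ∀ a → (a ≡ᵇ a) ≡ true
≡ᵇ-refl a = to T-≡ (≡⇒≡ᵇ a a refl)

≡ᵇ-false : ∀ a b → a ≢ b → (a ≡ᵇ b) ≡ false
≡ᵇ-false a b a≢b = ¬-not (a≢b ∘ ≡ᵇ-sound a b)

≡ᵇ-comm : ∀ a b → (a ≡ᵇ b) ≡ (b ≡ᵇ a)
≡ᵇ-comm zero    zero    = refl
≡ᵇ-comm zero    (suc b) = refl
≡ᵇ-comm (suc a) zero    = refl
≡ᵇ-comm (suc a) (suc b) = ≡ᵇ-comm a b

≤ᵇ-shift : ∀ x s b → x ≤ b → (x + s ≤ᵇ b) ≡ (s ≤ᵇ b ∸ x)
≤ᵇ-shift zero    s b       _         = refl
≤ᵇ-shift (suc x) s (suc b) (s≤s x≤b) = trans (<ᵇ-suc (x + s)) (≤ᵇ-shift x s b x≤b)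
  where
  <ᵇ-suc : ∀ a → (a <ᵇ suc b) ≡ (a ≤ᵇ b)
  <ᵇ-suc zero    = refl
  <ᵇ-suc (suc a) = refl

-- Finite sums

∑< : ℕ → (ℕ → ℕ) → ℕ
∑< zero    f = 0
∑< (suc n) f = f 0 + ∑< n (f ∘ suc)

syntax ∑< n (λ i → e) = ∑[ i < n ] e

∑-cong : ∀ n {f g : ℕ → ℕ} → (∀ i → i < n → f i ≡ g i) → ∑< n f ≡ ∑< n g
∑-cong zero    eq = refl
∑-cong (suc n) eq = cong₂ _+_ (eq 0 (s≤s z≤n)) (∑-cong n (λ i i<n → eq (suc i) (s≤s i<n)))

∑-mono : ∀ n {f g : ℕ → ℕ} → (∀ i → i < n → f i ≤ g i) → ∑< n f ≤ ∑< n g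
∑-mono zero    le = z≤n
∑-mono (suc n) le = +-mono-≤ (le 0 (s≤s z≤n)) (∑-mono n (λ i i<n → le (suc i) (s≤s i<n)))

∑-zero : ∀ n {f : ℕ → ℕ} → (∀ i → i < n → f i ≡ 0) → ∑< n f ≡ 0
∑-zero zero    eq = refl
∑-zero (suc n) eq = cong₂ _+_ (eq 0 (s≤s z≤n)) (∑-zero n (λ i i<n → eq (suc i) (s≤s i<n)))

∑-const : ∀ n c → ∑[ _ < n ] c ≡ n * c
∑-const zero    c = refl
∑-const (suc n) c = cong (c +_) (∑-const n c)

∑-+ : ∀ n (f g : ℕ → ℕ) → ∑[ i < n ] (f i + g i) ≡ ∑< n f + ∑< n g
∑-+ zero    f g = refl
∑-+ (suc n) f g = trans (cong (f 0 + g 0 +_) (∑-+ n (f ∘ suc) (g ∘ suc)))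
                        (+-+-comm (f 0) (g 0) (∑< n (f ∘ suc)) _)
  where
  +-+-comm : ∀ a b c e → a + b + (c + e) ≡ a + c + (b + e)
  +-+-comm = solve-∀

∑-*ˡ : ∀ n a (f : ℕ → ℕ) → ∑[ i < n ] (a * f i) ≡ a * ∑< n f
∑-*ˡ zero    a f = sym (*-zeroʳ a)
∑-*ˡ (suc n) a f = trans (cong (a * f 0 +_) (∑-*ˡ n a (f ∘ suc))) (sym (*-distribˡ-+ a (f 0) _))

∑-split : ∀ a b (f : ℕ → ℕ) → ∑< (a + b) f ≡ ∑< a f + ∑[ i < b ] f (a + i)
∑-split zero    b f = refl
∑-split (suc a) b f = trans (cong (f 0 +_) (∑-split a b (f ∘ suc))) (sym (+-assoc (f 0) _ _))

∑-truncate : ∀ {a n} (f : ℕ → ℕ) → a ≤ n → (∀ i → a ≤ i → f i ≡ 0) → ∑< n f ≡ ∑< a f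
∑-truncate {a} {n} f a≤n vanish = begin
  ∑< n f                                ≡⟨ cong (λ k → ∑< k f) (sym (m+[n∸m]≡n a≤n)) ⟩
  ∑< (a + (n ∸ a)) f                    ≡⟨ ∑-split a (n ∸ a) f ⟩
  ∑< a f + ∑[ i < n ∸ a ] f (a + i)     ≡⟨ cong (∑< a f +_) (∑-zero (n ∸ a) (λ i _ → vanish (a + i) (m≤m+n a i))) ⟩
  ∑< a f + 0                            ≡⟨ +-identityʳ _ ⟩
  ∑< a f                                ∎
  where open ≡-Reasoning

f≤∑ : ∀ n (f : ℕ → ℕ) {i} → i < n → f i ≤ ∑< n f
f≤∑ (suc n) f {zero}  _         = m≤m+n (f 0) _
f≤∑ (suc n) f {suc i} (s≤s i<n) = ≤-trans (f≤∑ n (f ∘ suc) i<n) (m≤n+m _ (f 0))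

∑-pos⇒∃ : ∀ n (f : ℕ → ℕ) → 0 < ∑< n f → ∃ λ i → i < n × 0 < f i
∑-pos⇒∃ (suc n) f pos with f 0 in eq
... | suc _ = 0 , s≤s z≤n , subst (0 <_) (sym eq) (s≤s z≤n)
... | zero with ∑-pos⇒∃ n (f ∘ suc) pos
...   | i , i<n , fi>0 = suc i , s≤s i<n , fi>0

∑-≤ᵇ : ∀ {m N} (f : ℕ → ℕ) → m ≤ N → ∑[ x < suc N ] (if x ≤ᵇ m then f x else 0) ≡ ∑< (suc m) f
∑-≤ᵇ {m} f m≤N =
  trans (∑-truncate _ (s≤s m≤N) (λ x m<x → cong (if_then f x else 0) (≤ᵇ-false m<x)))
        (∑-cong (suc m) (λ x x<1+m → cong (if_then f x else 0) (≤ᵇ-true (≤-pred x<1+m))))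

iverson : Bool → ℕ
iverson b = if b then 1 else 0

∑-pick : ∀ n (g : ℕ → ℕ) {u} → u < n → ∑[ i < n ] (if u ≡ᵇ i then g i else 0) ≡ g u
∑-pick (suc n) g {zero}  _         = trans (cong (g 0 +_) (∑-zero n (λ _ _ → refl))) (+-identityʳ _)
∑-pick (suc n) g {suc u} (s≤s u<n) = ∑-pick n (g ∘ suc) u<n

∑-iverson-< : ∀ n {k} → k ≤ n → ∑[ i < n ] iverson (i <ᵇ k) ≡ k
∑-iverson-< zero    {zero}  _         = refl
∑-iverson-< (suc n) {zero}  _         = ∑-zero n (λ _ _ → refl)
∑-iverson-< (suc n) {suc k} (s≤s k≤n) = cong suc (∑-iverson-< n k≤n)

private variable
  A : Set

filterᵇ-cong : ∀ {p q : A → Bool} → (∀ x → p x ≡ q x) → ∀ xs → filterᵇ p xs ≡ filterᵇ q xs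
filterᵇ-cong {p = p} {q = q} eq []       = refl
filterᵇ-cong {p = p} {q = q} eq (x ∷ xs) with p x | q x | eq x
... | true  | true  | refl = cong (x ∷_) (filterᵇ-cong eq xs)
... | false | false | refl = filterᵇ-cong eq xs

filterᵇ-none : ∀ {p : A → Bool} → (∀ x → p x ≡ false) → ∀ xs → filterᵇ p xs ≡ []
filterᵇ-none {p = p} none []       = refl
filterᵇ-none {p = p} none (x ∷ xs) rewrite none x = filterᵇ-none none xs

length≡sum-map-1 : ∀ (xs : List A) → length xs ≡ sum (map (λ _ → 1) xs)
length≡sum-map-1 []       = refl
length≡sum-map-1 (x ∷ xs) = cong suc (length≡sum-map-1 xs)

sum-map-*ˡ : ∀ a (f : A → ℕ) xs → sum (map (λ x → a * f x) xs) ≡ a * sum (map f xs)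
sum-map-*ˡ a f []       = sym (*-zeroʳ a)
sum-map-*ˡ a f (x ∷ xs) = trans (cong (a * f x +_) (sum-map-*ˡ a f xs)) (sym (*-distribˡ-+ a (f x) _))

sum-map-++ : ∀ (f : A → ℕ) xs ys → sum (map f (xs ++ ys)) ≡ sum (map f xs) + sum (map f ys)
sum-map-++ f xs ys = trans (cong sum (map-++ f xs ys)) (sum-++ (map f xs) (map f ys))

sum-map-filter-∷ : ∀ (h : List A → ℕ) (p : List A → Bool) x L →
  sum (map h (filterᵇ p (map (x ∷_) L))) ≡ sum (map (h ∘ (x ∷_)) (filterᵇ (p ∘ (x ∷_)) L))
sum-map-filter-∷ h p x []      = refl
sum-map-filter-∷ h p x (v ∷ L) with p (x ∷ v)
... | true  = cong (h (x ∷ v) +_) (sum-map-filter-∷ h p x L)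
... | false = sum-map-filter-∷ h p x L

sum-map-filter-concatMap : ∀ (h : List A → ℕ) (p : List A → Bool) L Y →
  sum (map h (filterᵇ p (concatMap (λ x → map (x ∷_) L) Y)))
    ≡ sum (map (λ x → sum (map (h ∘ (x ∷_)) (filterᵇ (p ∘ (x ∷_)) L))) Y)
sum-map-filter-concatMap h p L []      = refl
sum-map-filter-concatMap h p L (x ∷ Y) = begin
  sum (map h (filterᵇ p (map (x ∷_) L ++ rest)))
    ≡⟨ cong (sum ∘ map h) (filter-++ (T? ∘ p) (map (x ∷_) L) rest) ⟩
  sum (map h (filterᵇ p (map (x ∷_) L) ++ filterᵇ p rest))
    ≡⟨ sum-map-++ h (filterᵇ p (map (x ∷_) L)) (filterᵇ p rest) ⟩
  sum (map h (filterᵇ p (map (x ∷_) L))) + sum (map h (filterᵇ p rest))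
    ≡⟨ cong₂ _+_ (sum-map-filter-∷ h p x L) (sum-map-filter-concatMap h p L Y) ⟩
  sum (map (h ∘ (x ∷_)) (filterᵇ (p ∘ (x ∷_)) L))
    + sum (map (λ x → sum (map (h ∘ (x ∷_)) (filterᵇ (p ∘ (x ∷_)) L))) Y) ∎
  where
  open ≡-Reasoning
  rest = concatMap (λ x → map (x ∷_) L) Y

length-filter-concatMap : ∀ (p : List A → Bool) L Y →
  length (filterᵇ p (concatMap (λ x → map (x ∷_) L) Y)) ≡ sum (map (λ x → length (filterᵇ (p ∘ (x ∷_)) L)) Y)
length-filter-concatMap p L Y = begin
  length (filterᵇ p (concatMap (λ x → map (x ∷_) L) Y))
    ≡⟨ length≡sum-map-1 (filterᵇ p (concatMap (λ x → map (x ∷_) L) Y)) ⟩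
  sum (map (λ _ → 1) (filterᵇ p (concatMap (λ x → map (x ∷_) L) Y)))
    ≡⟨ sum-map-filter-concatMap (λ _ → 1) p L Y ⟩
  sum (map (λ x → sum (map (λ _ → 1) (filterᵇ (p ∘ (x ∷_)) L))) Y)
    ≡⟨ cong sum (map-cong (λ x → sym (length≡sum-map-1 (filterᵇ (p ∘ (x ∷_)) L))) Y) ⟩
  sum (map (λ x → length (filterᵇ (p ∘ (x ∷_)) L)) Y) ∎
  where open ≡-Reasoning

length-filter-∧ˡ : ∀ c (q : A → Bool) L → length (filterᵇ (λ v → c ∧ q v) L) ≡ (if c then length (filterᵇ q L) else 0)
length-filter-∧ˡ true  q L = refl
length-filter-∧ˡ false q L = cong length (filterᵇ-none (λ _ → refl) L)

sum-map-applyUpTo : ∀ (g f : ℕ → ℕ) n → sum (map g (applyUpTo f n)) ≡ ∑[ i < n ] g (f i)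
sum-map-applyUpTo g f zero    = refl
sum-map-applyUpTo g f (suc n) = cong (g (f 0) +_) (sum-map-applyUpTo g (f ∘ suc) n)

sum-map-range1 : ∀ (g : ℕ → ℕ) n → sum (map g (range1 n)) ≡ ∑[ i < n ] g (suc i)
sum-map-range1 g n = trans (cong (sum ∘ map g) (map-upTo suc n)) (sum-map-applyUpTo g suc n)

allLists-length : ∀ r (X : List ℕ) → All (λ w → length w ≡ r) (allLists r X)
allLists-length zero    X = refl ∷ []
allLists-length (suc r) X =
  concat⁺ (map⁺ (All.universal (λ x → map⁺ (All.map (cong suc) (allLists-length r X))) X))

∑-fibres : ∀ (u : A → ℕ) (g : ℕ → ℕ) N L → All (λ w → u w < N) L →
  ∑[ i < N ] (length (filterᵇ (λ w → u w ≡ᵇ i) L) * g i) ≡ sum (map (g ∘ u) L)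
∑-fibres u g N []      []             = ∑-zero N (λ _ _ → refl)
∑-fibres u g N (w ∷ L) (uw<N ∷ bound) = begin
  ∑[ i < N ] (length (filterᵇ (λ w → u w ≡ᵇ i) (w ∷ L)) * g i)     ≡⟨ ∑-cong N (λ i _ → split i) ⟩
  ∑[ i < N ] ((if u w ≡ᵇ i then g i else 0) + fibre i)              ≡⟨ ∑-+ N _ fibre ⟩
  ∑[ i < N ] (if u w ≡ᵇ i then g i else 0) + ∑< N fibre             ≡⟨ cong₂ _+_ (∑-pick N g uw<N) (∑-fibres u g N L bound) ⟩
  g (u w) + sum (map (g ∘ u) L)                                      ∎
  where
  open ≡-Reasoning
  fibre : ℕ → ℕ
  fibre i = length (filterᵇ (λ w → u w ≡ᵇ i) L) * g i
  split : ∀ i → length (filterᵇ (λ w → u w ≡ᵇ i) (w ∷ L)) * g i ≡ (if u w ≡ᵇ i then g i else 0) + fibre i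
  split i with u w ≡ᵇ i
  ... | true  = refl
  ... | false = refl

elem-map-suc : ∀ y L → elem (suc y) (map suc L) ≡ elem y L
elem-map-suc y []      = refl
elem-map-suc y (q ∷ L) = cong (if y ≡ᵇ q then true else_) (elem-map-suc y L)

elem-zero-map-suc : ∀ L → elem 0 (map suc L) ≡ false
elem-zero-map-suc []      = refl
elem-zero-map-suc (q ∷ L) = elem-zero-map-suc L

elem-upTo : ∀ y k → elem y (upTo k) ≡ (y <ᵇ k)
elem-upTo y       zero    = refl
elem-upTo zero    (suc k) = refl
elem-upTo (suc y) (suc k) =
  trans (cong (elem (suc y)) (sym (map-upTo suc k))) (trans (elem-map-suc y (upTo k)) (elem-upTo y k))

elem-range1 : ∀ y k → elem y (range1 k) ≡ ((1 ≤ᵇ y) ∧ (y ≤ᵇ k))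
elem-range1 zero    k = elem-zero-map-suc (upTo k)
elem-range1 (suc y) k = trans (elem-map-suc y (upTo k)) (elem-upTo y k)

∉⇒≢ : ∀ occ {x y} → elem x occ ≡ false → elem y occ ≡ true → x ≢ y
∉⇒≢ occ x∉occ y∈occ refl = contradiction (trans (sym y∈occ) x∉occ) λ ()

largestFree-max : ∀ occ s x → 1 ≤ x → x ≤ s → elem x occ ≡ false → x ≤ largestFree s occ
largestFree-max occ zero    x 1≤x x≤0 _ = contradiction x≤0 (<⇒≱ 1≤x)
largestFree-max occ (suc s) x 1≤x x≤s x∉occ with elem (suc s) occ in s∈occ
... | false = x≤s
... | true  = largestFree-max occ s x 1≤x (≤-pred (≤∧≢⇒< x≤s (∉⇒≢ occ x∉occ s∈occ))) x∉occ

largestFree-free : ∀ occ s x → 1 ≤ x → x ≤ s → elem x occ ≡ false →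
  1 ≤ largestFree s occ × largestFree s occ ≤ s × elem (largestFree s occ) occ ≡ false
largestFree-free occ zero    x 1≤x x≤0 _ = contradiction x≤0 (<⇒≱ 1≤x)
largestFree-free occ (suc s) x 1≤x x≤s x∉occ with elem (suc s) occ in s∈occ
... | false = s≤s z≤n , ≤-refl , s∈occ
... | true  with largestFree-free occ s x 1≤x (≤-pred (≤∧≢⇒< x≤s (∉⇒≢ occ x∉occ s∈occ))) x∉occ
...   | 1≤f , f≤s , f∉occ = 1≤f , m≤n⇒m≤1+n f≤s , f∉occ

-- Lattice points of the dilated polytope

module LatticePoints (m : ℕ) where

  boxed : ℕ → ℕ → Bool
  boxed zero    x = true
  boxed (suc j) x = x ≤ᵇ m

  -- points j r b = #{x ∈ ℕ^r : x₁,…,x_j ≤ m, x₁ + ⋯ + x_r ≤ b}, by recursion on x₁.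
  points : ℕ → ℕ → ℕ → ℕ
  points j zero    b = 1
  points j (suc r) b = ∑[ x < suc b ] (if boxed j x then points (pred j) r (b ∸ x) else 0)

  points-box-vacuous : ∀ j r c → j < r → c ≤ m → points j r c ≡ points (suc j) r c
  points-box-vacuous zero (suc r) c _ c≤m = ∑-cong (suc c) summand
    where
    summand : ∀ x → x < suc c → points zero r (c ∸ x) ≡ (if x ≤ᵇ m then points zero r (c ∸ x) else 0)
    summand x x<1+c rewrite ≤ᵇ-true (≤-trans (≤-pred x<1+c) c≤m) = refl
  points-box-vacuous (suc j) (suc r) c j<r c≤m = ∑-cong (suc c) summand
    where
    summand : ∀ x → x < suc c →
      (if x ≤ᵇ m then points j r (c ∸ x) else 0) ≡ (if x ≤ᵇ m then points (suc j) r (c ∸ x) else 0)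
    summand x x<1+c rewrite ≤ᵇ-true (≤-trans (≤-pred x<1+c) c≤m) =
      points-box-vacuous j r (c ∸ x) (≤-pred j<r) (≤-trans (m∸n≤m c x) c≤m)

  points-unbox : ∀ j r c → j < r → points j r (c + suc m) ≡ points (suc j) r (c + suc m) + points j r c
  points-unbox zero (suc r) c _ = begin
    ∑< (suc N) f                                 ≡⟨ cong (λ k → ∑< k f) (+-comm (suc c) (suc m)) ⟩
    ∑< (suc m + suc c) f                         ≡⟨ ∑-split (suc m) (suc c) f ⟩
    ∑< (suc m) f + ∑[ i < suc c ] f (suc m + i)  ≡⟨ cong₂ _+_ (sym (∑-≤ᵇ f (≤-trans (n≤1+n m) (m≤n+m (suc m) c))))
                                                              (∑-cong (suc c) (λ i _ → shift i)) ⟩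
    points 1 (suc r) N + points zero (suc r) c   ∎
    where
    open ≡-Reasoning
    N = c + suc m
    f : ℕ → ℕ
    f x = points zero r (N ∸ x)
    shift : ∀ i → f (suc m + i) ≡ points zero r (c ∸ i)
    shift i = cong (points zero r) (trans (cong (_∸ (suc m + i)) (+-comm c (suc m))) ([m+n]∸[m+o]≡n∸o (suc m) c i))
  points-unbox (suc j) (suc r) c j<r = begin
    points (suc j) (suc r) N                      ≡⟨ ∑-cong (suc N) (λ x _ → split x) ⟩
    ∑[ x < suc N ] (g x + h x)                   ≡⟨ ∑-+ (suc N) g h ⟩
    ∑< (suc N) g + ∑< (suc N) h                  ≡⟨ cong (∑< (suc N) g +_) (∑-≤ᵇ (λ x → if x ≤ᵇ m then points j r (c ∸ x) else 0) (m≤m+n c (suc m))) ⟩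
    points (suc (suc j)) (suc r) N + points (suc j) (suc r) c ∎
    where
    open ≡-Reasoning
    N = c + suc m
    g h : ℕ → ℕ
    g x = if x ≤ᵇ m then points (suc j) r (N ∸ x) else 0
    h x = if x ≤ᵇ c then (if x ≤ᵇ m then points j r (c ∸ x) else 0) else 0
    split : ∀ x → (if x ≤ᵇ m then points j r (N ∸ x) else 0) ≡ g x + h x
    split x with x ≤? m | x ≤? c
    ... | no x≰m | yes x≤c rewrite ≤ᵇ-false (≰⇒> x≰m) | ≤ᵇ-true x≤c = refl
    ... | no x≰m | no x≰c  rewrite ≤ᵇ-false (≰⇒> x≰m) | ≤ᵇ-false (≰⇒> x≰c) = refl
    ... | yes x≤m | yes x≤c rewrite ≤ᵇ-true x≤m | ≤ᵇ-true x≤c | +-∸-comm (suc m) x≤c =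
      points-unbox j r (c ∸ x) (≤-pred j<r)
    ... | yes x≤m | no x≰c rewrite ≤ᵇ-true x≤m | ≤ᵇ-false (≰⇒> x≰c) =
      trans (points-box-vacuous j r (N ∸ x) (≤-pred j<r) N∸x≤m) (sym (+-identityʳ _))
      where
      N∸x≤m : N ∸ x ≤ m
      N∸x≤m = m≤n+o⇒m∸n≤o N x (subst (_≤ x + m) (sym (+-suc c m)) (+-monoˡ-≤ m (≰⇒> x≰c)))

  -- points 0 r b is the binomial coefficient C(b + r, r); these are two absorption identities.
  mutual
    simplex-dim-step : ∀ r b → suc r * points 0 (suc r) b ≡ (b + suc r) * points 0 r b
    simplex-dim-step r zero    = cong (suc r *_) (+-identityʳ (points 0 r 0))
    simplex-dim-step r (suc b) = begin
      suc r * (X + Y)                ≡⟨ *-distribˡ-+ (suc r) X Y ⟩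
      suc r * X + suc r * Y          ≡⟨ cong (suc r * X +_) (trans (simplex-dim-step r b) (sym (simplex-bound-step r b))) ⟩
      suc r * X + suc b * X          ≡⟨ sym (*-distribʳ-+ X (suc r) (suc b)) ⟩
      (suc r + suc b) * X            ≡⟨ cong (_* X) (+-comm (suc r) (suc b)) ⟩
      (suc b + suc r) * X            ∎
      where
      open ≡-Reasoning
      X = points 0 r (suc b)
      Y = points 0 (suc r) b

    simplex-bound-step : ∀ r b → suc b * points 0 r (suc b) ≡ (b + suc r) * points 0 r b
    simplex-bound-step zero    b = cong (_* 1) (+-comm 1 b)
    simplex-bound-step (suc r) b = begin
      suc b * (X + Y)                ≡⟨ *-distribˡ-+ (suc b) X Y ⟩
      suc b * X + suc b * Y          ≡⟨ cong (_+ suc b * Y) (trans (simplex-bound-step r b) (sym (simplex-dim-step r b))) ⟩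
      suc r * Y + suc b * Y          ≡⟨ sym (*-distribʳ-+ Y (suc r) (suc b)) ⟩
      (suc r + suc b) * Y            ≡⟨ cong (_* Y) (trans (+-suc (suc r) b) (+-comm (suc (suc r)) b)) ⟩
      (b + suc (suc r)) * Y          ∎
      where
      open ≡-Reasoning
      X = points 0 r (suc b)
      Y = points 0 (suc r) b

  Recurrence : ℕ → ℕ → ℕ → Set
  Recurrence j r b = suc r * points j (suc r) b + j * suc m * points j r b
                   ≡ suc m * j * points (pred j) r b + (b + suc r) * points j r b

  recurrence-unboxed : ∀ r b → Recurrence 0 r b
  recurrence-unboxed r b = begin
    suc r * points 0 (suc r) b + 0               ≡⟨ +-identityʳ _ ⟩
    suc r * points 0 (suc r) b                   ≡⟨ simplex-dim-step r b ⟩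
    (b + suc r) * points 0 r b                   ≡⟨ cong (_+ (b + suc r) * points 0 r b) (sym (cong (_* points 0 r b) (*-zeroʳ (suc m)))) ⟩
    suc m * 0 * points 0 r b + (b + suc r) * points 0 r b ∎
    where open ≡-Reasoning

  recurrence-step-small : ∀ j r b → suc j ≤ r → b ≤ m → Recurrence j r b → Recurrence (suc j) r b
  recurrence-step-small j r b j<r b≤m ih
    rewrite sym (points-box-vacuous j (suc r) b (m≤n⇒m≤1+n j<r) b≤m)
          | sym (points-box-vacuous j r b j<r b≤m) = begin
    suc r * U + suc j * suc m * P                   ≡⟨ expand (suc r) U j (suc m) P ⟩
    (suc r * U + j * suc m * P) + suc m * P         ≡⟨ cong (_+ suc m * P) ih ⟩
    suc m * j * Z + B * P + suc m * P               ≡⟨ cong (λ t → t + B * P + suc m * P) (scaled-pred j j<r) ⟩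
    suc m * j * P + B * P + suc m * P               ≡⟨ collect (suc m) j P (B * P) ⟩
    suc m * suc j * P + B * P                       ∎
    where
    open ≡-Reasoning
    U = points j (suc r) b
    P = points j r b
    Z = points (pred j) r b
    B = b + suc r
    scaled-pred : ∀ j → suc j ≤ r → suc m * j * points (pred j) r b ≡ suc m * j * points j r b
    scaled-pred zero    _   = refl
    scaled-pred (suc j) j<r = cong (suc m * suc j *_) (points-box-vacuous j r b (<⇒≤ j<r) b≤m)
    expand : ∀ R U J sm P → R * U + suc J * sm * P ≡ (R * U + J * sm * P) + sm * P
    expand = solve-∀
    collect : ∀ sm J P X → sm * J * P + X + sm * P ≡ sm * suc J * P + X
    collect = solve-∀

  recurrence-step-large : ∀ j r c → suc j ≤ r →
    Recurrence j r (c + suc m) → Recurrence j r c → Recurrence (suc j) r (c + suc m)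
  recurrence-step-large j r c j<r ih-b ih-c =
    subst (λ P → suc r * U₁ + suc j * suc m * P₁ ≡ suc m * suc j * P + (b + suc r) * P₁) (sym unbox-P)
      (cancel (suc r) j (suc m) c U₁ U₀ P₁ P₀ Z₁ Z₀
        (subst₂ (λ U P → suc r * U + j * suc m * P ≡ suc m * j * Z₁ + (b + suc r) * P) unbox-U unbox-P ih-b)
        ih-c (scaled-pred j j<r))
    where
    b = c + suc m
    U₁ = points (suc j) (suc r) b
    U₀ = points j (suc r) c
    P₁ = points (suc j) r b
    P₀ = points j r c
    Z₁ = points (pred j) r b
    Z₀ = points (pred j) r c
    unbox-U : points j (suc r) b ≡ U₁ + U₀
    unbox-U = points-unbox j (suc r) c (m≤n⇒m≤1+n j<r)
    unbox-P : points j r b ≡ P₁ + P₀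
    unbox-P = points-unbox j r c j<r
    scaled-pred : ∀ j → suc j ≤ r →
      j * points (pred j) r b ≡ j * (points (suc j) r b + points j r c) + j * points (pred j) r c
    scaled-pred zero    _   = refl
    scaled-pred (suc j) j<r = begin
      suc j * points j r b                                              ≡⟨ cong (suc j *_) (points-unbox j r c (<⇒≤ j<r)) ⟩
      suc j * (points (suc j) r b + points j r c)                       ≡⟨ *-distribˡ-+ (suc j) (points (suc j) r b) (points j r c) ⟩
      suc j * points (suc j) r b + suc j * points j r c                 ≡⟨ cong (λ t → suc j * t + suc j * points j r c) (points-unbox (suc j) r c j<r) ⟩
      suc j * (points (suc (suc j)) r b + points (suc j) r c) + suc j * points j r c ∎
      where open ≡-Reasoning
    -- The identity at b minus the one at c, with the subtraction moved across so that it can be cancelled.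
    cancel : ∀ R J sm c U₁ U₀ P₁ P₀ Z₁ Z₀ →
      R * (U₁ + U₀) + J * sm * (P₁ + P₀) ≡ sm * J * Z₁ + (c + sm + R) * (P₁ + P₀) →
      R * U₀ + J * sm * P₀ ≡ sm * J * Z₀ + (c + R) * P₀ →
      J * Z₁ ≡ J * (P₁ + P₀) + J * Z₀ →
      R * U₁ + suc J * sm * P₁ ≡ sm * suc J * (P₁ + P₀) + (c + sm + R) * P₁
    cancel R J sm c U₁ U₀ P₁ P₀ Z₁ Z₀ at-b at-c scaled = +-cancelʳ-≡ _ _ _ (begin
      R * U₁ + suc J * sm * P₁ + K                            ≡⟨ regroup R J sm c U₁ U₀ P₁ P₀ Z₁ Z₀ ⟩
      sm * suc J * (P₁ + P₀) + (c + sm + R) * P₁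
        + (R * (U₁ + U₀) + J * sm * (P₁ + P₀) + (sm * J * Z₀ + (c + R) * P₀) + sm * (J * Z₁))
                                                              ≡⟨ cong (sm * suc J * (P₁ + P₀) + (c + sm + R) * P₁ +_)
                                                                   (cong₂ _+_ (cong₂ _+_ at-b (sym at-c)) (cong (sm *_) scaled)) ⟩
      sm * suc J * (P₁ + P₀) + (c + sm + R) * P₁ + K          ∎)
      where
      open ≡-Reasoning
      K = sm * J * Z₁ + (c + sm + R) * (P₁ + P₀) + (R * U₀ + J * sm * P₀) + sm * (J * (P₁ + P₀) + J * Z₀)
      regroup : ∀ R J sm c U₁ U₀ P₁ P₀ Z₁ Z₀ →
        R * U₁ + suc J * sm * P₁
          + (sm * J * Z₁ + (c + sm + R) * (P₁ + P₀) + (R * U₀ + J * sm * P₀) + sm * (J * (P₁ + P₀) + J * Z₀))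
        ≡ sm * suc J * (P₁ + P₀) + (c + sm + R) * P₁
          + (R * (U₁ + U₀) + J * sm * (P₁ + P₀) + (sm * J * Z₀ + (c + R) * P₀) + sm * (J * Z₁))
      regroup = solve-∀

  points-recurrence : ∀ j r b → j ≤ r → Recurrence j r b
  points-recurrence zero    r b _   = recurrence-unboxed r b
  points-recurrence (suc j) r b j<r with b ≤? m
  ... | yes b≤m = recurrence-step-small j r b j<r b≤m (points-recurrence j r b (<⇒≤ j<r))
  ... | no  b≰m = subst (Recurrence (suc j) r) (m∸n+n≡m (≰⇒> b≰m))
    (recurrence-step-large j r (b ∸ suc m) j<r (points-recurrence j r _ (<⇒≤ j<r)) (points-recurrence j r _ (<⇒≤ j<r)))

  points-box-full : ∀ j c → j * m ≤ c → points j j c ≡ suc m ^ j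
  points-box-full zero    c _     = refl
  points-box-full (suc j) c jm≤c = begin
    ∑[ x < suc c ] (if x ≤ᵇ m then points j j (c ∸ x) else 0) ≡⟨ ∑-≤ᵇ (λ x → points j j (c ∸ x)) (m+n≤o⇒m≤o m jm≤c) ⟩
    ∑[ x < suc m ] points j j (c ∸ x)                          ≡⟨ ∑-cong (suc m) (λ x x≤m → points-box-full j (c ∸ x) (fits x (≤-pred x≤m))) ⟩
    ∑[ _ < suc m ] (suc m ^ j)                                 ≡⟨ ∑-const (suc m) (suc m ^ j) ⟩
    suc m * suc m ^ j                                          ∎
    where
    open ≡-Reasoning
    fits : ∀ x → x ≤ m → j * m ≤ c ∸ x
    fits x x≤m = m+n≤o⇒m≤o∸n (j * m) (≤-trans (+-monoʳ-≤ (j * m) x≤m) (subst (_≤ c) (+-comm m (j * m)) jm≤c))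

module EhrhartTable (m d : ℕ) where

  ehr : ℕ → ℕ → ℕ
  ehr zero    zero    = 1
  ehr zero    (suc j) = 0
  ehr (suc r) j       = suc m * j * ehr r (pred j) + (suc m * (suc r ∸ j) + m * (d ∸ suc r)) * ehr r j

  ehr-vanishes : ∀ r j → r < j → ehr r j ≡ 0
  ehr-vanishes zero    (suc j) _         = refl
  ehr-vanishes (suc r) (suc j) (s≤s r<j)
    rewrite ehr-vanishes r j r<j | ehr-vanishes r (suc j) (m≤n⇒m≤1+n r<j) =
      annihilate (suc m) (suc j) (suc m * (suc r ∸ suc j) + m * (d ∸ suc r))
    where
    annihilate : ∀ a b c → a * b * 0 + c * 0 ≡ 0
    annihilate = solve-∀

module _ (m d : ℕ) where
  open LatticePoints m
  open EhrhartTable m d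

  -- Multiplying by F = r! and splitting m·d + (r + 1) = m·(d − r − 1) + (m + 1)·(r + 1 − j) + (m + 1)·j.
  scale-recurrence : ∀ J s₁ s₂ R D F U P Z → J + s₁ ≡ R → R + s₂ ≡ D →
    R * U + J * suc m * P ≡ suc m * J * Z + (m * D + R) * P →
    R * F * U ≡ suc m * J * (F * Z) + (suc m * s₁ + m * s₂) * (F * P)
  scale-recurrence J s₁ s₂ _ _ F U P Z refl refl rec = +-cancelʳ-≡ _ _ _ (begin
    R * F * U + F * (J * suc m * P)                   ≡⟨ factor R F U J (suc m) P ⟩
    F * (R * U + J * suc m * P)                       ≡⟨ cong (F *_) rec ⟩
    F * (suc m * J * Z + (m * (J + s₁ + s₂) + (J + s₁)) * P)
                                                      ≡⟨ distribute F J Z m s₁ s₂ P ⟩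
    suc m * J * (F * Z) + (suc m * s₁ + m * s₂) * (F * P) + F * (J * suc m * P) ∎)
    where
    open ≡-Reasoning
    R = J + s₁
    factor : ∀ R F U J sm P → R * F * U + F * (J * sm * P) ≡ F * (R * U + J * sm * P)
    factor = solve-∀
    distribute : ∀ F J Z m s₁ s₂ P → F * (suc m * J * Z + (m * (J + s₁ + s₂) + (J + s₁)) * P)
      ≡ suc m * J * (F * Z) + (suc m * s₁ + m * s₂) * (F * P) + F * (J * suc m * P)
    distribute = solve-∀

  factorial*points≡ehr : ∀ r j → j ≤ r → r ≤ d → r ! * points j r (m * d) ≡ ehr r j
  factorial*points≡ehr zero    zero _ _ = refl
  factorial*points≡ehr (suc r) j j≤1+r 1+r≤d with j ≤? r
  ... | yes j≤r = begin
    suc r * r ! * points j (suc r) (m * d)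
      ≡⟨ scale-recurrence j (suc r ∸ j) (d ∸ suc r) (suc r) d (r !) _ _ _
           (m+[n∸m]≡n j≤1+r) (m+[n∸m]≡n 1+r≤d) (points-recurrence j r (m * d) j≤r) ⟩
    suc m * j * (r ! * points (pred j) r (m * d)) + (suc m * (suc r ∸ j) + m * (d ∸ suc r)) * (r ! * points j r (m * d))
      ≡⟨ cong₂ (λ z p → suc m * j * z + (suc m * (suc r ∸ j) + m * (d ∸ suc r)) * p)
           (factorial*points≡ehr r (pred j) (≤-trans pred[n]≤n j≤r) r≤d) (factorial*points≡ehr r j j≤r r≤d) ⟩
    ehr (suc r) j ∎
    where
    open ≡-Reasoning
    r≤d = <⇒≤ 1+r≤d
  ... | no j≰r rewrite ≤-antisym j≤1+r (≰⇒> j≰r)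
                     | ehr-vanishes r (suc r) ≤-refl
                     | sym (factorial*points≡ehr r r ≤-refl (<⇒≤ 1+r≤d))
                     | points-box-full (suc r) (m * d) (subst (suc r * m ≤_) (*-comm d m) (*-monoˡ-≤ m 1+r≤d))
                     | points-box-full r (m * d) (subst (r * m ≤_) (*-comm d m) (*-monoˡ-≤ m (<⇒≤ 1+r≤d))) =
    rearrange (suc r) (r !) (suc m) (suc m ^ r) (suc m * (suc r ∸ suc r) + m * (d ∸ suc r))
    where
    rearrange : ∀ R F s T X → R * F * (s * T) ≡ s * R * (F * T) + X * 0
    rearrange = solve-∀

module _ (m : ℕ) where
  open LatticePoints m

  bounded-∷ : ∀ j b x v → x ≤ b →
    (firstBounded j m (x ∷ v) ∧ (x + sum v ≤ᵇ b)) ≡ (boxed j x ∧ (firstBounded (pred j) m v ∧ (sum v ≤ᵇ b ∸ x)))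
  bounded-∷ zero    b x v x≤b = ≤ᵇ-shift x (sum v) b x≤b
  bounded-∷ (suc j) b x v x≤b =
    trans (∧-assoc (x ≤ᵇ m) (firstBounded j m v) _)
          (cong (λ t → (x ≤ᵇ m) ∧ (firstBounded j m v ∧ t)) (≤ᵇ-shift x (sum v) b x≤b))

  length-filter-allLists≡points : ∀ R j r b → b ≤ R →
    length (filterᵇ (λ x → firstBounded j m x ∧ (sum x ≤ᵇ b)) (allLists r (range0 R))) ≡ points j r b
  length-filter-allLists≡points R zero    zero    b _   = refl
  length-filter-allLists≡points R (suc j) zero    b _   = refl
  length-filter-allLists≡points R j       (suc r) b b≤R = begin
    length (filterᵇ p (allLists (suc r) (range0 R))) ≡⟨ length-filter-concatMap p L (range0 R) ⟩
    sum (map count (range0 R))                      ≡⟨ sum-map-applyUpTo count id (suc R) ⟩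
    ∑< (suc R) count                                ≡⟨ ∑-truncate count (s≤s b≤R) beyond ⟩
    ∑< (suc b) count                                ≡⟨ ∑-cong (suc b) (λ x x≤b → within x (≤-pred x≤b)) ⟩
    points j (suc r) b                              ∎
    where
    open ≡-Reasoning
    p : List ℕ → Bool
    p x = firstBounded j m x ∧ (sum x ≤ᵇ b)
    L = allLists r (range0 R)
    count : ℕ → ℕ
    count x = length (filterᵇ (p ∘ (x ∷_)) L)
    beyond : ∀ x → suc b ≤ x → count x ≡ 0
    beyond x b<x = cong length (filterᵇ-none
      (λ v → trans (cong (firstBounded j m (x ∷ v) ∧_) (≤ᵇ-false (≤-trans b<x (m≤m+n x (sum v))))) (∧-zeroʳ _)) L)
    within : ∀ x → x ≤ b → count x ≡ (if boxed j x then points (pred j) r (b ∸ x) else 0)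
    within x x≤b = begin
      count x
        ≡⟨ cong length (filterᵇ-cong (λ v → bounded-∷ j b x v x≤b) L) ⟩
      length (filterᵇ (λ v → boxed j x ∧ (firstBounded (pred j) m v ∧ (sum v ≤ᵇ b ∸ x))) L)
        ≡⟨ length-filter-∧ˡ (boxed j x) _ L ⟩
      (if boxed j x then length (filterᵇ (λ v → firstBounded (pred j) m v ∧ (sum v ≤ᵇ b ∸ x)) L) else 0)
        ≡⟨ cong (if boxed j x then_else 0) (length-filter-allLists≡points R (pred j) r (b ∸ x) (≤-trans (m∸n≤m b x) b≤R)) ⟩
      (if boxed j x then points (pred j) r (b ∸ x) else 0) ∎

  latticeCount≡points : ∀ n d k → latticeCount n d k m ≡ points k n (m * d)
  latticeCount≡points n d k = length-filter-allLists≡points (m * d) k n (m * d) ≤-refl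

-- The parking process

module Parking (n d m : ℕ) (n≤d : n ≤ d) where
  open EhrhartTable m d

  vacant : List ℕ → ℕ → Bool
  vacant occ p = (1 ≤ᵇ p) ∧ (p ≤ᵇ n) ∧ not (elem p occ)

  weight : List ℕ → List ℕ → ℕ
  weight occ []       = 1
  weight occ (p ∷ ps) = if vacant occ p then suc m * weight (p ∷ occ) ps else m * weight (largestFree n occ ∷ occ) ps

  parkUnlucky≤length : ∀ occ ps → parkUnlucky n occ ps ≤ length ps
  parkUnlucky≤length occ []       = z≤n
  parkUnlucky≤length occ (p ∷ ps) with vacant occ p
  ... | true  = m≤n⇒m≤1+n (parkUnlucky≤length (p ∷ occ) ps)
  ... | false = s≤s (parkUnlucky≤length (largestFree n occ ∷ occ) ps)

  weight≡powers : ∀ occ ps → weight occ ps ≡ m ^ parkUnlucky n occ ps * suc m ^ (length ps ∸ parkUnlucky n occ ps)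
  weight≡powers occ []       = refl
  weight≡powers occ (p ∷ ps) with vacant occ p
  ... | true rewrite weight≡powers (p ∷ occ) ps | +-∸-assoc 1 (parkUnlucky≤length (p ∷ occ) ps) =
    x*[y*z]≡y*[x*z] (suc m) (m ^ parkUnlucky n (p ∷ occ) ps) _
    where
    x*[y*z]≡y*[x*z] : ∀ x y z → x * (y * z) ≡ y * (x * z)
    x*[y*z]≡y*[x*z] = solve-∀
  ... | false rewrite weight≡powers (largestFree n occ ∷ occ) ps = sym (*-assoc m _ _)

  magicRHS≡sum-weight : ∀ k → magicRHS n d k m ≡ sum (map (weight []) (W n d k))
  magicRHS≡sum-weight k = begin
    magicRHS n d k m                         ≡⟨ sum-map-applyUpTo (λ i → coeff n d k i * g i) id (suc n) ⟩
    ∑[ i < suc n ] (coeff n d k i * g i)     ≡⟨ ∑-fibres (unlucky n) g (suc n) (W n d k) (All.map (λ {w} → unlucky≤n w) lengths) ⟩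
    sum (map (g ∘ unlucky n) (W n d k))      ≡⟨ cong sum (map-cong-local (All.map (λ {w} → g∘unlucky≡weight w) lengths)) ⟩
    sum (map (weight []) (W n d k))          ∎
    where
    open ≡-Reasoning
    g : ℕ → ℕ
    g i = m ^ i * (1 + m) ^ (n ∸ i)
    lengths : All (λ w → length w ≡ n) (W n d k)
    lengths = filter⁺ _ (allLists-length n (range1 d))
    unlucky≤n : ∀ w → length w ≡ n → unlucky n w < suc n
    unlucky≤n w refl = s≤s (parkUnlucky≤length [] w)
    g∘unlucky≡weight : ∀ w → length w ≡ n → g (unlucky n w) ≡ weight [] w
    g∘unlucky≡weight w refl = sym (weight≡powers [] w)

  contains : List ℕ → List ℕ → Bool
  contains Rq w = and (map (λ j → elem j w) Rq)

  remove : ℕ → List ℕ → List ℕ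
  remove p = filterᵇ (λ j → not (j ≡ᵇ p))

  -- Words w of length r are parked after the spaces in occ are taken; Rq lists the values w must contain.
  weightedWords : List ℕ → List ℕ → ℕ → ℕ
  weightedWords occ Rq r = sum (map (weight occ) (filterᵇ (contains Rq) (allLists r (range1 d))))

  contains-∷ : ∀ Rq p v → contains Rq (p ∷ v) ≡ contains (remove p Rq) v
  contains-∷ []       p v = refl
  contains-∷ (j ∷ Rq) p v with j ≡ᵇ p
  ... | true  = contains-∷ Rq p v
  ... | false = cong (elem j v ∧_) (contains-∷ Rq p v)

  firstCar : List ℕ → List ℕ → ℕ → ℕ → ℕ
  firstCar occ Rq r p = if vacant occ p then suc m * weightedWords (p ∷ occ) (remove p Rq) r
                                        else m * weightedWords (largestFree n occ ∷ occ) (remove p Rq) r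

  weightedWords-suc : ∀ occ Rq r → weightedWords occ Rq (suc r) ≡ ∑[ i < d ] firstCar occ Rq r (suc i)
  weightedWords-suc occ Rq r = begin
    weightedWords occ Rq (suc r)
      ≡⟨ sum-map-filter-concatMap (weight occ) (contains Rq) L (range1 d) ⟩
    sum (map (λ p → sum (map (weight occ ∘ (p ∷_)) (filterᵇ (contains Rq ∘ (p ∷_)) L))) (range1 d))
      ≡⟨ cong sum (map-cong first-car (range1 d)) ⟩
    sum (map (firstCar occ Rq r) (range1 d))
      ≡⟨ sum-map-range1 (firstCar occ Rq r) d ⟩
    ∑[ i < d ] firstCar occ Rq r (suc i) ∎
    where
    open ≡-Reasoning
    L = allLists r (range1 d)
    first-car : ∀ p → sum (map (weight occ ∘ (p ∷_)) (filterᵇ (contains Rq ∘ (p ∷_)) L)) ≡ firstCar occ Rq r p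
    first-car p rewrite filterᵇ-cong (contains-∷ Rq p) L with vacant occ p
    ... | true  = sum-map-*ˡ (suc m) (weight (p ∷ occ)) (filterᵇ (contains (remove p Rq)) L)
    ... | false = sum-map-*ˡ m (weight (largestFree n occ ∷ occ)) (filterᵇ (contains (remove p Rq)) L)

  elem-remove : ∀ y p Rq → elem y (remove p Rq) ≡ (elem y Rq ∧ not (y ≡ᵇ p))
  elem-remove y p []       = refl
  elem-remove y p (j ∷ Rq) with j ≡ᵇ p in j≡p | y ≡ᵇ j in y≡j
  ... | true  | true  rewrite ≡ᵇ-sound y j y≡j | j≡p =
    trans (elem-remove j p Rq) (trans (cong (λ b → elem j Rq ∧ not b) j≡p) (∧-zeroʳ _))
  ... | true  | false = elem-remove y p Rq
  ... | false | true  rewrite ≡ᵇ-sound y j y≡j | j≡p | ≡ᵇ-refl j = refl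
  ... | false | false = trans (cong (if_then true else elem y (remove p Rq)) y≡j) (elem-remove y p Rq)

  remove-⊆ : ∀ y p Rq → elem y (remove p Rq) ≡ true → elem y Rq ≡ true
  remove-⊆ y p Rq y∈Rq′ = ∧-conicalˡ _ _ (trans (sym (elem-remove y p Rq)) y∈Rq′)

  vacant-∷ : ∀ q occ y → vacant (q ∷ occ) y ≡ (vacant occ y ∧ not (y ≡ᵇ q))
  vacant-∷ q occ y = and-not-if (1 ≤ᵇ y) (y ≤ᵇ n) (y ≡ᵇ q) (elem y occ)
    where
    and-not-if : ∀ a b c e → (a ∧ b ∧ not (if c then true else e)) ≡ ((a ∧ b ∧ not e) ∧ not c)
    and-not-if true  true  true  true  = refl
    and-not-if true  true  true  false = refl
    and-not-if true  true  false e     = sym (∧-identityʳ _)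
    and-not-if true  false c     e     = refl
    and-not-if false b     c     e     = refl

  vacant-sound : ∀ occ y → vacant occ y ≡ true → 1 ≤ y × y ≤ n × elem y occ ≡ false
  vacant-sound occ y v
    with 1≤y ← ∧-conicalˡ _ _ v | rest ← ∧-conicalʳ (1 ≤ᵇ y) _ v =
      ≤ᵇ-sound 1 y 1≤y , ≤ᵇ-sound y n (∧-conicalˡ _ _ rest) , not-injective (∧-conicalʳ (y ≤ᵇ n) _ rest)

  vacant-intro : ∀ occ y → 1 ≤ y → y ≤ n → elem y occ ≡ false → vacant occ y ≡ true
  vacant-intro occ y 1≤y y≤n y∉occ rewrite ≤ᵇ-true 1≤y | ≤ᵇ-true y≤n | y∉occ = refl

  count : (ℕ → Bool) → ℕ
  count P = ∑[ i < d ] iverson (P (suc i))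

  count-cong : ∀ {P Q : ℕ → Bool} → (∀ y → P y ≡ Q y) → count P ≡ count Q
  count-cong eq = ∑-cong d (λ i _ → cong iverson (eq (suc i)))

  count-mono : ∀ {P Q : ℕ → Bool} → (∀ y → P y ≡ true → Q y ≡ true) → count P ≤ count Q
  count-mono {P} {Q} P⇒Q = ∑-mono d (λ i _ → iverson-mono (suc i))
    where
    iverson-mono : ∀ y → iverson (P y) ≤ iverson (Q y)
    iverson-mono y with P y in Py
    ... | false = z≤n
    ... | true rewrite P⇒Q y Py = ≤-refl

  count-pos : ∀ (P : ℕ → Bool) y → P y ≡ true → 1 ≤ y → y ≤ d → 1 ≤ count P
  count-pos P (suc i) Py _ i<d = ≤-trans (≤-reflexive (cong iverson (sym Py))) (f≤∑ d (λ i → iverson (P (suc i))) i<d)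

  count-witness : ∀ (P : ℕ → Bool) → 1 ≤ count P → ∃ λ y → P y ≡ true
  count-witness P pos with ∑-pos⇒∃ d (λ i → iverson (P (suc i))) pos
  ... | i , _ , Pi>0 with P (suc i) in Pi
  ...   | true = suc i , Pi

  count-split : ∀ (P Q : ℕ → Bool) → count (λ y → P y ∧ Q y) + count (λ y → P y ∧ not (Q y)) ≡ count P
  count-split P Q = trans (sym (∑-+ d _ _)) (∑-cong d (λ i _ → split (P (suc i)) (Q (suc i))))
    where
    split : ∀ a b → iverson (a ∧ b) + iverson (a ∧ not b) ≡ iverson a
    split true  true  = refl
    split true  false = refl
    split false b     = refl

  count-compl : ∀ (P : ℕ → Bool) → count P + count (not ∘ P) ≡ d
  count-compl P = trans (count-split (λ _ → true) P) (trans (∑-const d 1) (*-identityʳ d))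

  count-≡ᵇ : ∀ (P : ℕ → Bool) p → 1 ≤ p → p ≤ d → count (λ y → P y ∧ (y ≡ᵇ p)) ≡ iverson (P p)
  count-≡ᵇ P (suc p) _ p<d = trans (∑-cong d (λ i _ → at i)) (∑-pick d (λ i → iverson (P (suc i))) p<d)
    where
    at : ∀ i → iverson (P (suc i) ∧ (i ≡ᵇ p)) ≡ (if p ≡ᵇ i then iverson (P (suc i)) else 0)
    at i rewrite ≡ᵇ-comm i p with p ≡ᵇ i
    ... | true  = cong iverson (∧-identityʳ _)
    ... | false = cong iverson (∧-zeroʳ _)

  count-remove : ∀ (P : ℕ → Bool) p → 1 ≤ p → p ≤ d → count (λ y → P y ∧ not (y ≡ᵇ p)) + iverson (P p) ≡ count P
  count-remove P p 1≤p p≤d = begin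
    count (λ y → P y ∧ not (y ≡ᵇ p)) + iverson (P p)             ≡⟨ +-comm _ (iverson (P p)) ⟩
    iverson (P p) + count (λ y → P y ∧ not (y ≡ᵇ p))             ≡⟨ cong (_+ count (λ y → P y ∧ not (y ≡ᵇ p))) (sym (count-≡ᵇ P p 1≤p p≤d)) ⟩
    count (λ y → P y ∧ (y ≡ᵇ p)) + count (λ y → P y ∧ not (y ≡ᵇ p)) ≡⟨ count-split P (_≡ᵇ p) ⟩
    count P                                                      ∎
    where open ≡-Reasoning

  vacant≤largestFree : ∀ occ x → vacant occ x ≡ true → x ≤ largestFree n occ
  vacant≤largestFree occ x vx with 1≤x , x≤n , x∉occ ← vacant-sound occ x vx = largestFree-max occ n x 1≤x x≤n x∉occ

  largestFree-vacant : ∀ occ x → vacant occ x ≡ true → vacant occ (largestFree n occ) ≡ true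
  largestFree-vacant occ x vx
    with 1≤x , x≤n , x∉occ ← vacant-sound occ x vx
    with 1≤f , f≤n , f∉occ ← largestFree-free occ n x 1≤x x≤n x∉occ = vacant-intro occ _ 1≤f f≤n f∉occ

  #required : List ℕ → ℕ
  #required Rq = count (λ y → elem y Rq)

  record Invariant (r : ℕ) (occ Rq : List ℕ) : Set where
    field
      vacancies        : count (vacant occ) ≡ r
      required-vacant  : ∀ y → elem y Rq ≡ true → vacant occ y ≡ true
      required-initial : ∀ x y → vacant occ x ≡ true → elem y Rq ≡ true → x < y → elem x Rq ≡ true

  -- The first car prefers p and takes q: q is not a value still required, and p is q or not vacant.
  invariant-park : ∀ r occ Rq p q → Invariant (suc r) occ Rq → vacant occ q ≡ true → q ≤ d →
    (∀ y → elem y (remove p Rq) ≡ true → (y ≡ᵇ q) ≡ false) →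
    (∀ x → vacant occ x ≡ true → (x ≡ᵇ q) ≡ false → (x ≡ᵇ p) ≡ false) →
    Invariant r (q ∷ occ) (remove p Rq)
  invariant-park r occ Rq p q inv vq q≤d q∉Rq′ p-only-q = record
    { vacancies        = vacancies′
    ; required-vacant  = required-vacant′
    ; required-initial = required-initial′
    }
    where
    open Invariant inv
    vacancies′ : count (vacant (q ∷ occ)) ≡ r
    vacancies′ = suc-injective (begin
      suc (count (vacant (q ∷ occ)))                              ≡⟨ cong suc (count-cong (vacant-∷ q occ)) ⟩
      suc (count (λ y → vacant occ y ∧ not (y ≡ᵇ q)))             ≡⟨ +-comm 1 _ ⟩
      count (λ y → vacant occ y ∧ not (y ≡ᵇ q)) + 1                ≡⟨ cong (λ b → count (λ y → vacant occ y ∧ not (y ≡ᵇ q)) + iverson b) (sym vq) ⟩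
      count (λ y → vacant occ y ∧ not (y ≡ᵇ q)) + iverson (vacant occ q)
                                                                  ≡⟨ count-remove (vacant occ) q (proj₁ (vacant-sound occ q vq)) q≤d ⟩
      count (vacant occ)                                          ≡⟨ vacancies ⟩
      suc r                                                       ∎)
      where open ≡-Reasoning
    required-vacant′ : ∀ y → elem y (remove p Rq) ≡ true → vacant (q ∷ occ) y ≡ true
    required-vacant′ y y∈Rq′
      rewrite vacant-∷ q occ y | required-vacant y (remove-⊆ y p Rq y∈Rq′) | q∉Rq′ y y∈Rq′ = refl
    required-initial′ : ∀ x y → vacant (q ∷ occ) x ≡ true → elem y (remove p Rq) ≡ true → x < y →
      elem x (remove p Rq) ≡ true
    required-initial′ x y vx y∈Rq′ x<y
      with vx₀ ← ∧-conicalˡ _ _ (trans (sym (vacant-∷ q occ x)) vx)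
      rewrite elem-remove x p Rq
            | required-initial x y vx₀ (remove-⊆ y p Rq y∈Rq′) x<y
            | p-only-q x vx₀ (not-injective (∧-conicalʳ _ _ (trans (sym (vacant-∷ q occ x)) vx))) = refl

  #required-remove : ∀ p Rq → 1 ≤ p → p ≤ d → #required (remove p Rq) + iverson (elem p Rq) ≡ #required Rq
  #required-remove p Rq 1≤p p≤d =
    trans (cong (_+ iverson (elem p Rq)) (count-cong (λ y → elem-remove y p Rq))) (count-remove (λ y → elem y Rq) p 1≤p p≤d)

  weightedWords-too-short : ∀ r occ Rq → r < #required Rq → weightedWords occ Rq r ≡ 0
  weightedWords-too-short zero    occ []       0<# = contradiction (subst (0 <_) (∑-zero d (λ _ _ → refl)) 0<#) (<-irrefl refl)
  weightedWords-too-short zero    occ (_ ∷ _)  _   = refl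
  weightedWords-too-short (suc r) occ Rq       r<# =
    trans (weightedWords-suc occ Rq r) (∑-zero d (λ i i<d → first-car (suc i) (s≤s z≤n) i<d))
    where
    shorter : ∀ p → 1 ≤ p → p ≤ d → r < #required (remove p Rq)
    shorter p 1≤p p≤d = ≤-pred (begin
      suc (suc r)                    ≤⟨ r<# ⟩
      #required Rq                   ≡⟨ sym (#required-remove p Rq 1≤p p≤d) ⟩
      #′ + iverson (elem p Rq)       ≤⟨ +-monoʳ-≤ #′ (iverson≤1 (elem p Rq)) ⟩
      #′ + 1                         ≡⟨ +-comm #′ 1 ⟩
      suc #′                         ∎)
      where
      open ≤-Reasoning
      #′ = #required (remove p Rq)
      iverson≤1 : ∀ b → iverson b ≤ 1
      iverson≤1 true  = ≤-refl
      iverson≤1 false = z≤n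
    first-car : ∀ p → 1 ≤ p → p ≤ d → firstCar occ Rq r p ≡ 0
    first-car p 1≤p p≤d
      rewrite weightedWords-too-short r (p ∷ occ) (remove p Rq) (shorter p 1≤p p≤d)
            | weightedWords-too-short r (largestFree n occ ∷ occ) (remove p Rq) (shorter p 1≤p p≤d) with vacant occ p
    ... | true  = *-zeroʳ (suc m)
    ... | false = *-zeroʳ m

  ∑-if-if : ∀ (P Q : ℕ → Bool) a b c →
    ∑[ i < d ] (if P (suc i) then (if Q (suc i) then a else b) else c)
      ≡ a * count (λ y → P y ∧ Q y) + b * count (λ y → P y ∧ not (Q y)) + c * count (not ∘ P)
  ∑-if-if P Q a b c =
    trans (∑-cong d (λ i _ → expand (P (suc i)) (Q (suc i))))
    (trans (∑-+ d _ _) (cong₂ _+_ (trans (∑-+ d _ _) (cong₂ _+_ (∑-*ˡ d a _) (∑-*ˡ d b _))) (∑-*ˡ d c _)))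
    where
    pick₁ : ∀ a b c → a ≡ a * 1 + b * 0 + c * 0
    pick₁ = solve-∀
    pick₂ : ∀ a b c → b ≡ a * 0 + b * 1 + c * 0
    pick₂ = solve-∀
    pick₃ : ∀ a b c → c ≡ a * 0 + b * 0 + c * 1
    pick₃ = solve-∀
    expand : ∀ u v → (if u then (if v then a else b) else c)
                     ≡ a * iverson (u ∧ v) + b * iverson (u ∧ not v) + c * iverson (not u)
    expand true  true  = pick₁ a b c
    expand true  false = pick₂ a b c
    expand false v     = pick₃ a b c

  WeightedWordsFormula : ℕ → Set
  WeightedWordsFormula r = ∀ occ Rq → Invariant r occ Rq → weightedWords occ Rq r ≡ ehr r (#required Rq)

  module FirstCar (r : ℕ) (ih : WeightedWordsFormula r) {occ Rq : List ℕ} (inv : Invariant (suc r) occ Rq) where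
    open Invariant inv

    j : ℕ
    j = #required Rq

    vacant-first-car : ∀ p → 1 ≤ p → p ≤ d → vacant occ p ≡ true →
      suc m * weightedWords (p ∷ occ) (remove p Rq) r ≡ (if elem p Rq then suc m * ehr r (pred j) else suc m * ehr r j)
    vacant-first-car p 1≤p p≤d vp =
      trans (cong (suc m *_) (ih (p ∷ occ) (remove p Rq) inv′)) (by-case (elem p Rq) (#required-remove p Rq 1≤p p≤d))
      where
      inv′ : Invariant r (p ∷ occ) (remove p Rq)
      inv′ = invariant-park r occ Rq p p inv vp p≤d
        (λ y y∈Rq′ → not-injective (∧-conicalʳ _ _ (trans (sym (elem-remove y p Rq)) y∈Rq′)))
        (λ _ _ x≢p → x≢p)
      #′ = #required (remove p Rq)
      by-case : ∀ b → #′ + iverson b ≡ j → suc m * ehr r #′ ≡ (if b then suc m * ehr r (pred j) else suc m * ehr r j)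
      by-case true  #′+1≡j = cong (λ t → suc m * ehr r t) (cong pred (trans (+-comm 1 #′) #′+1≡j))
      by-case false #′+0≡j = cong (λ t → suc m * ehr r t) (trans (sym (+-identityʳ #′)) #′+0≡j)

    occupied-first-car : ∀ p → vacant occ p ≡ false → weightedWords (largestFree n occ ∷ occ) (remove p Rq) r ≡ ehr r j
    occupied-first-car p op = by-case (elem lf Rq) refl
      where
      lf = largestFree n occ
      p∉Rq : elem p Rq ≡ false
      p∉Rq = ¬-not (λ p∈Rq → contradiction (trans (sym (required-vacant p p∈Rq)) op) λ ())
      #′≡j : #required (remove p Rq) ≡ j
      #′≡j = count-cong (λ y → trans (elem-remove y p Rq) (unaffected y))
        where
        unaffected : ∀ y → (elem y Rq ∧ not (y ≡ᵇ p)) ≡ elem y Rq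
        unaffected y with y ≡ᵇ p in y≡p
        ... | false = ∧-identityʳ _
        ... | true rewrite ≡ᵇ-sound y p y≡p | p∉Rq = refl
      some-vacancy : ∃ λ x → vacant occ x ≡ true
      some-vacancy = count-witness (vacant occ) (subst (1 ≤_) (sym vacancies) (s≤s z≤n))
      lf-vacant : vacant occ lf ≡ true
      lf-vacant = largestFree-vacant occ (proj₁ some-vacancy) (proj₂ some-vacancy)
      by-case : ∀ b → elem lf Rq ≡ b → weightedWords (lf ∷ occ) (remove p Rq) r ≡ ehr r j
      by-case true lf∈Rq =
        trans (weightedWords-too-short r (lf ∷ occ) (remove p Rq) (subst (r <_) (sym #′≡j) r<j)) (sym (ehr-vanishes r j r<j))
        where
        -- the required values form an initial segment of the vacant spaces and include the largest one
        all-required : ∀ x → vacant occ x ≡ true → elem x Rq ≡ true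
        all-required x vx with x ≟ lf
        ... | yes refl = lf∈Rq
        ... | no  x≢lf = required-initial x lf vx lf∈Rq (≤∧≢⇒< (vacant≤largestFree occ x vx) x≢lf)
        r<j : r < j
        r<j = subst (_≤ j) vacancies (count-mono all-required)
      by-case false lf∉Rq = trans (ih (lf ∷ occ) (remove p Rq) inv′) (cong (ehr r) #′≡j)
        where
        inv′ : Invariant r (lf ∷ occ) (remove p Rq)
        inv′ = invariant-park r occ Rq p lf inv lf-vacant
          (≤-trans (proj₁ (proj₂ (vacant-sound occ lf lf-vacant))) n≤d)
          (λ y y∈Rq′ → ≡ᵇ-false y lf λ { refl → contradiction (trans (sym (remove-⊆ y p Rq y∈Rq′)) lf∉Rq) λ () })
          (λ x vx _ → ≡ᵇ-false x p λ { refl → contradiction (trans (sym vx) op) λ () })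

    first-car : ∀ p → 1 ≤ p → p ≤ d → firstCar occ Rq r p
      ≡ (if vacant occ p then (if elem p Rq then suc m * ehr r (pred j) else suc m * ehr r j) else m * ehr r j)
    first-car p 1≤p p≤d with vacant occ p in vp
    ... | true  = vacant-first-car p 1≤p p≤d vp
    ... | false = cong (m *_) (occupied-first-car p vp)

    vacant-required : count (λ y → vacant occ y ∧ elem y Rq) ≡ j
    vacant-required = count-cong agree
      where
      agree : ∀ y → (vacant occ y ∧ elem y Rq) ≡ elem y Rq
      agree y with elem y Rq in y∈Rq
      ... | true rewrite required-vacant y y∈Rq = refl
      ... | false = ∧-zeroʳ _

    vacant-optional : count (λ y → vacant occ y ∧ not (elem y Rq)) ≡ suc r ∸ j
    vacant-optional = trans (sym (m+n∸m≡n j _)) (cong (_∸ j) (begin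
      j + count (λ y → vacant occ y ∧ not (elem y Rq))
        ≡⟨ cong (_+ count (λ y → vacant occ y ∧ not (elem y Rq))) (sym vacant-required) ⟩
      count (λ y → vacant occ y ∧ elem y Rq) + count (λ y → vacant occ y ∧ not (elem y Rq))
        ≡⟨ count-split (vacant occ) (λ y → elem y Rq) ⟩
      count (vacant occ)
        ≡⟨ vacancies ⟩
      suc r ∎))
      where open ≡-Reasoning

    occupied : count (not ∘ vacant occ) ≡ d ∸ suc r
    occupied = trans (sym (m+n∸m≡n (suc r) _))
      (cong (_∸ suc r) (trans (cong (_+ count (not ∘ vacant occ)) (sym vacancies)) (count-compl (vacant occ))))

  weightedWords≡ehr : ∀ r → WeightedWordsFormula r
  weightedWords≡ehr zero    occ []       inv = cong (ehr 0) (sym (∑-zero d (λ _ _ → refl)))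
  weightedWords≡ehr zero    occ (y ∷ Rq) inv =
    contradiction (subst (1 ≤_) vacancies (count-pos (vacant occ) y vy 1≤y (≤-trans y≤n n≤d))) λ ()
    where
    open Invariant inv
    vy = required-vacant y (cong (if_then true else elem y Rq) (≡ᵇ-refl y))
    1≤y = proj₁ (vacant-sound occ y vy)
    y≤n = proj₁ (proj₂ (vacant-sound occ y vy))
  weightedWords≡ehr (suc r) occ Rq       inv = begin
    weightedWords occ Rq (suc r)
      ≡⟨ weightedWords-suc occ Rq r ⟩
    ∑[ i < d ] firstCar occ Rq r (suc i)
      ≡⟨ ∑-cong d (λ i i<d → first-car (suc i) (s≤s z≤n) i<d) ⟩
    ∑[ i < d ] (if vacant occ (suc i) then (if elem (suc i) Rq then a else b) else c)
      ≡⟨ ∑-if-if (vacant occ) (λ y → elem y Rq) a b c ⟩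
    a * count (λ y → vacant occ y ∧ elem y Rq) + b * count (λ y → vacant occ y ∧ not (elem y Rq))
      + c * count (not ∘ vacant occ)
      ≡⟨ cong₂ _+_ (cong₂ _+_ (cong (a *_) vacant-required) (cong (b *_) vacant-optional)) (cong (c *_) occupied) ⟩
    a * j + b * (suc r ∸ j) + c * (d ∸ suc r)
      ≡⟨ regroup (suc m) m (ehr r (pred j)) (ehr r j) j (suc r ∸ j) (d ∸ suc r) ⟩
    ehr (suc r) j ∎
    where
    open ≡-Reasoning
    open FirstCar r (weightedWords≡ehr r) inv
    a b c : ℕ
    a = suc m * ehr r (pred j)
    b = suc m * ehr r j
    c = m * ehr r j
    regroup : ∀ sm m Z P j s₁ s₂ → sm * Z * j + sm * P * s₁ + m * P * s₂ ≡ sm * j * Z + (sm * s₁ + m * s₂) * P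
    regroup = solve-∀

  initial-invariant : ∀ k → k ≤ n → Invariant n [] (range1 k)
  initial-invariant k k≤n = record
    { vacancies        = trans (∑-cong d (λ i _ → cong iverson (∧-identityʳ (i <ᵇ n)))) (∑-iverson-< d n≤d)
    ; required-vacant  = required-vacant
    ; required-initial = required-initial
    }
    where
    range1-bounds : ∀ y → elem y (range1 k) ≡ true → 1 ≤ y × y ≤ k
    range1-bounds y y∈ with e ← trans (sym (elem-range1 y k)) y∈ =
      ≤ᵇ-sound 1 y (∧-conicalˡ _ _ e) , ≤ᵇ-sound y k (∧-conicalʳ (1 ≤ᵇ y) _ e)
    required-vacant : ∀ y → elem y (range1 k) ≡ true → vacant [] y ≡ true
    required-vacant y y∈ with 1≤y , y≤k ← range1-bounds y y∈ = vacant-intro [] y 1≤y (≤-trans y≤k k≤n) refl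
    required-initial : ∀ x y → vacant [] x ≡ true → elem y (range1 k) ≡ true → x < y → elem x (range1 k) ≡ true
    required-initial x y vx y∈ x<y rewrite elem-range1 x k
      | ≤ᵇ-true (proj₁ (vacant-sound [] x vx)) = ≤ᵇ-true (≤-trans (<⇒≤ x<y) (proj₂ (range1-bounds y y∈)))

  #required-range1 : ∀ k → k ≤ d → #required (range1 k) ≡ k
  #required-range1 k k≤d = trans (∑-cong d (λ i _ → cong iverson (elem-range1 (suc i) k))) (∑-iverson-< d k≤d)

  magicRHS≡ehr : ∀ k → k ≤ n → magicRHS n d k m ≡ ehr n k
  magicRHS≡ehr k k≤n = begin
    magicRHS n d k m                     ≡⟨ magicRHS≡sum-weight k ⟩
    weightedWords [] (range1 k) n        ≡⟨ weightedWords≡ehr n [] (range1 k) (initial-invariant k k≤n) ⟩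
    ehr n (#required (range1 k))         ≡⟨ cong (ehr n) (#required-range1 k (≤-trans k≤n n≤d)) ⟩
    ehr n k                              ∎
    where open ≡-Reasoning

theorem5p1 : (n d k : ℕ) → 1 ≤ n → n ≤ d → k ≤ n →
    (m : ℕ) → n ! * latticeCount n d k m ≡ magicRHS n d k m
theorem5p1 n d k _ n≤d k≤n m = begin
  n ! * latticeCount n d k m           ≡⟨ cong (n ! *_) (latticeCount≡points m n d k) ⟩
  n ! * points k n (m * d)             ≡⟨ factorial*points≡ehr m d n k k≤n n≤d ⟩
  ehr n k                              ≡⟨ sym (magicRHS≡ehr k k≤n) ⟩
  magicRHS n d k m                     ∎
  where
  open ≡-Reasoning
  open LatticePoints m using (points)
  open EhrhartTable m d using (ehr)
  open Parking n d m n≤d using (magicRHS≡ehr)
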